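{- Let $G=(V,E)$ be a finite undirected graph without loops (parallel edges allowed). An orientation of $G$ is decreasingly minimal (its in-degree vector is decreasingly minimal among the in-degree vectors of all orientations of $G$) if and only if it is increasingly maximal (its in-degree vector is increasingly maximal among the in-degree vectors of all orientations of $G$).
   Context: The in-degree vector of an orientation $D$ assigns to each node $v$ the number $\varrho_D(v)$ of arcs with head $v$. For a vector $x$, $x{\downarrow}$ ($x{\uparrow}$) sorts the components decreasingly (increasingly); $m\in Q$ is decreasingly minimal if $m{\downarrow}$ is lexicographically $\le y{\downarrow}$ for all $y\in Q$, and increasingly maximal if $m{\uparrow}$ is lexicographically $\ge y{\uparrow}$ for all $y\in Q$. -}

module Defs where

open import Data.Nat using (ℕ; _≤_)
open import Data.Nat.Properties using (≤-decTotalOrder)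
open import Data.Fin using (Fin)
open import Data.Fin.Properties using () renaming (_≟_ to _≟ᶠ_)
open import Data.Bool using (Bool; true; false)
open import Data.Product using (_×_; _,_; proj₁; proj₂)
open import Data.List using (List; length; filter; map; reverse)
open import Data.List.Base using (allFin)
open import Data.List.Relation.Binary.Lex.NonStrict using (Lex-≤)
open import Relation.Binary.PropositionalEquality using (_≡_; _≢_)
import Data.List.Sort as Sort

-- A finite loopless multigraph on node set Fin n with m edges (edges
-- indexed by Fin m, so parallel edges are allowed).
record Graph (n m : ℕ) : Set where
  field
    ends     : Fin m → Fin n × Fin n
    loopless : ∀ e → proj₁ (ends e) ≢ proj₂ (ends e)
open Graph public

-- An orientation chooses, for every edge, which endpoint is the head:
-- true  : the edge is oriented  proj₁ → proj₂  (head = proj₂)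
-- false : the edge is oriented  proj₂ → proj₁  (head = proj₁)
Orientation : ℕ → Set
Orientation m = Fin m → Bool

head : ∀ {n m} → Graph n m → Orientation m → Fin m → Fin n
head G D e with D e
... | true  = proj₂ (ends G e)
... | false = proj₁ (ends G e)

indeg : ∀ {n m} → Graph n m → Orientation m → Fin n → ℕ
indeg G D v = length (filter (λ e → head G D e ≟ᶠ v) (allFin _))

inVec : ∀ {n m} → Graph n m → Orientation m → List ℕ
inVec {n} G D = map (indeg G D) (allFin n)

sortInc : List ℕ → List ℕ
sortInc = Sort.sort ≤-decTotalOrder

sortDec : List ℕ → List ℕ
sortDec xs = reverse (sortInc xs)

_≤lex_ : List ℕ → List ℕ → Set
_≤lex_ = Lex-≤ _≡_ _≤_

DecMin : ∀ {n m} → Graph n m → Orientation m → Set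
DecMin {m = m} G D = (D' : Orientation m) → sortDec (inVec G D) ≤lex sortDec (inVec G D')

IncMax : ∀ {n m} → Graph n m → Orientation m → Set
IncMax {m = m} G D = (D' : Orientation m) → sortInc (inVec G D') ≤lex sortInc (inVec G D)

module Submission where

-- Reversing an arc from u to v moves one unit of in-degree from v to u. If ϱ(v) ≥ ϱ(u) + 2 this
-- strictly improves both the decreasingly and the increasingly sorted in-degree vector (compared
-- through the threshold counts #{v : ϱ(v) ≤ j} and #{v : ϱ(v) ≥ j}); if ϱ(v) = ϱ(u) + 1 the two
-- in-degrees are swapped and nothing changes. Hence a decreasingly minimal or increasingly maximal
-- orientation D has no directed path from s to t with ϱ(t) ≥ ϱ(s) + 2: walking along such a path
-- and reversing its level arcs eventually exposes a strictly improving reversal.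
-- Conversely, let D have no such path and let D′ be any orientation. Reversing in D′ an arc on
-- which D′ disagrees with D and which runs uphill in D′ brings D′ closer to D without making it
-- worse. Once no such arc is left, every arc of D reversed in D′ runs downhill in D′, and comparing
-- the in-degree sums of D and D′ over vertex sets closed under these arcs gives ϱ_D = ϱ_D′.
-- So D is at least as good as every orientation for both orders at once.

open import Defs
open import Level using (0ℓ)
open import Function using (_∘_; flip; id)
open import Function.Bundles using (_⇔_; mk⇔)
open import Data.Empty using (⊥-elim)
open import Data.Product using (_×_; _,_; proj₁; proj₂; ∃)
open import Data.Sum using (_⊎_; inj₁; inj₂)
open import Data.Bool using (Bool; true; false; not) renaming (_≟_ to _≟ᵇ_)
open import Data.Bool.Properties using (¬-not; not-¬)
open import Data.Nat using (ℕ; zero; suc; _+_; _*_; _≤_; _<_; _≤?_; z≤n; s≤s; s≤s⁻¹)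
open import Data.Nat.Properties
open import Data.Nat.ListAction using (sum)
open import Data.Nat.ListAction.Properties using (sum-↭)
open import Data.Nat.Tactic.RingSolver using (solve-∀)
open import Data.Fin using (Fin; punchIn)
open import Data.Fin.Properties using (punchInᵢ≢i; ¬∀⟶∃¬; any?) renaming (_≟_ to _≟ᶠ_)
open import Data.Vec.Functional using (updateAt; removeAt)
open import Data.Vec.Functional.Properties using (updateAt-updates; updateAt-minimal)
open import Data.List using (List; []; _∷_; length; filter; map; tabulate; reverse)
open import Data.List.Base using (allFin)
open import Data.List.Properties using (length-tabulate; unfold-reverse; map-tabulate; map-cong)
open import Data.List.Relation.Unary.All using (All; []; _∷_)
import Data.List.Relation.Unary.All as All
open import Data.List.Relation.Unary.AllPairs using (AllPairs; []; _∷_)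
import Data.List.Relation.Unary.AllPairs.Properties as AllPairs
open import Data.List.Relation.Unary.Sorted.TotalOrder.Properties using (Sorted⇒AllPairs)
open import Data.List.Relation.Binary.Lex.Core using (halt; this; next)
open import Data.List.Relation.Binary.Lex.NonStrict using (Lex-<)
import Data.List.Relation.Binary.Lex.NonStrict as Lex
open import Data.List.Relation.Binary.Pointwise using (≡⇒Pointwise-≡)
open import Data.List.Relation.Binary.Permutation.Propositional using (_↭_; ↭-sym; ↭-trans; ↭-reflexive)
open import Data.List.Relation.Binary.Permutation.Propositional.Properties
  using (map⁺; ↭-length; ↭-reverse; All-resp-↭)
open import Data.List.Sort ≤-decTotalOrder using (sort-↭; sort-↗)
open import Relation.Nullary using (Dec; yes; no; ¬_; contradiction)
open import Relation.Nullary.Decidable using (_×-dec_; _⊎-dec_; ¬?; map′; decidable-stable)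
open import Relation.Unary using (Pred; Decidable)
open import Relation.Binary using (Rel; IsDecTotalOrder) renaming (Decidable to Decidable₂)
open import Relation.Binary.Definitions using (tri<; tri≈; tri>)
import Relation.Binary.Construct.Flip.EqAndOrd as Flip
open import Relation.Binary.Construct.Closure.ReflexiveTransitive using (Star; ε; _◅_; _◅◅_)
open import Relation.Binary.PropositionalEquality
open import Algebra.Properties.CommutativeMonoid.Sum +-0-commutativeMonoid
  using (sum-remove; sum-cong-≗; ∑-comm; sum-replicate-zero) renaming (sum to ∑)
open import Algebra.Properties.Semiring.Sum +-*-semiring using (*-distribˡ-sum)

𝟙 : ∀ {p} {P : Set p} → Dec P → ℕ
𝟙 (yes _) = 1
𝟙 (no _)  = 0

𝟙-yes : ∀ {p} {P : Set p} (d : Dec P) → P → 𝟙 d ≡ 1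
𝟙-yes (yes _) _  = refl
𝟙-yes (no ¬p) p  = contradiction p ¬p

𝟙-no : ∀ {p} {P : Set p} (d : Dec P) → ¬ P → 𝟙 d ≡ 0
𝟙-no (yes p) ¬p = contradiction p ¬p
𝟙-no (no _)  _  = refl

𝟙-mono : ∀ {p q} {P : Set p} {Q : Set q} (d : Dec P) (e : Dec Q) → (P → Q) → 𝟙 d ≤ 𝟙 e
𝟙-mono (yes p) e P⇒Q = ≤-reflexive (sym (𝟙-yes e (P⇒Q p)))
𝟙-mono (no _)  _ _   = z≤n

𝟙*-yes : ∀ {p} {P : Set p} (d : Dec P) → P → ∀ {x} → 𝟙 d * x ≡ x
𝟙*-yes d p {x} rewrite 𝟙-yes d p = +-identityʳ x

𝟙*-<⇒ : ∀ {p} {P : Set p} (d : Dec P) {x y} → 𝟙 d * x < 𝟙 d * y → P × x < y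
𝟙*-<⇒ (yes p) {x} {y} lt = p , subst₂ _<_ (+-identityʳ x) (+-identityʳ y) lt
𝟙*-<⇒ (no _)          lt = ⊥-elim (n≮n 0 lt)

𝟙≤1 : ∀ {p} {P : Set p} (d : Dec P) → 𝟙 d ≤ 1
𝟙≤1 (yes _) = ≤-refl
𝟙≤1 (no _)  = z≤n

count : ∀ {a p} {A : Set a} {P : Pred A p} → Decidable P → List A → ℕ
count P? xs = sum (map (𝟙 ∘ P?) xs)

length-filter : ∀ {a p} {A : Set a} {P : Pred A p} (P? : Decidable P) xs →
                length (filter P? xs) ≡ count P? xs
length-filter P? []       = refl
length-filter P? (x ∷ xs) with P? x
... | yes _ = cong suc (length-filter P? xs)
... | no _  = length-filter P? xs

count-↭ : ∀ {a p} {A : Set a} {P : Pred A p} (P? : Decidable P) {xs ys} →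
          xs ↭ ys → count P? xs ≡ count P? ys
count-↭ P? xs↭ys = sum-↭ (map⁺ (𝟙 ∘ P?) xs↭ys)

count-tabulate : ∀ {a p} {A : Set a} {P : Pred A p} (P? : Decidable P) {n} (f : Fin n → A) →
                 count P? (tabulate f) ≡ ∑ (𝟙 ∘ P? ∘ f)
count-tabulate P? {zero}  f = refl
count-tabulate P? {suc n} f = cong (𝟙 (P? (f Fin.zero)) +_) (count-tabulate P? (f ∘ Fin.suc))

∑-mono-≤ : ∀ {n} {f g : Fin n → ℕ} → (∀ i → f i ≤ g i) → ∑ f ≤ ∑ g
∑-mono-≤ {zero}  f≤g = z≤n
∑-mono-≤ {suc n} f≤g = +-mono-≤ (f≤g Fin.zero) (∑-mono-≤ (f≤g ∘ Fin.suc))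

∑-mono-< : ∀ {n} {f g : Fin n → ℕ} → (∀ i → f i ≤ g i) → ∀ t → f t < g t → ∑ f < ∑ g
∑-mono-< f≤g Fin.zero    ft<gt = +-mono-<-≤ ft<gt (∑-mono-≤ (f≤g ∘ Fin.suc))
∑-mono-< f≤g (Fin.suc t) ft<gt = +-mono-≤-< (f≤g Fin.zero) (∑-mono-< (f≤g ∘ Fin.suc) t ft<gt)

∑-≤⇒∃< : ∀ {n} {f g : Fin n → ℕ} → ∑ f ≤ ∑ g → ∀ t → g t < f t → ∃ λ s → f s < g s
∑-≤⇒∃< {n} {f} {g} ∑f≤∑g t gt<ft =
  let s , gs≰fs = ¬∀⟶∃¬ n (λ i → g i ≤ f i) (λ i → g i ≤? f i)
                    (λ g≤f → <⇒≱ (∑-mono-< g≤f t gt<ft) ∑f≤∑g)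
  in s , ≰⇒> gs≰fs

term≤∑ : ∀ {n} (f : Fin n → ℕ) i → f i ≤ ∑ f
term≤∑ f Fin.zero    = m≤m+n _ _
term≤∑ f (Fin.suc i) = ≤-trans (term≤∑ (f ∘ Fin.suc) i) (m≤n+m _ _)

∑-bounded : ∀ {n} {f : Fin n → ℕ} → (∀ i → f i ≤ 1) → ∑ f ≤ n
∑-bounded {zero}  f≤1 = z≤n
∑-bounded {suc n} f≤1 = +-mono-≤ (f≤1 Fin.zero) (∑-bounded (f≤1 ∘ Fin.suc))

∑-cong-except : ∀ {n} {f g : Fin n → ℕ} (p : Fin n) → (∀ i → i ≢ p → f i ≡ g i) →
                ∑ f + g p ≡ ∑ g + f p
∑-cong-except {suc n} {f} {g} p f≗g = begin
  ∑ f + g p                            ≡⟨ cong (_+ g p) (sum-remove {i = p} f) ⟩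
  f p + ∑ (removeAt f p) + g p         ≡⟨ cong (λ s → f p + s + g p) rest ⟩
  f p + ∑ (removeAt g p) + g p         ≡⟨ swap-outer (f p) (∑ (removeAt g p)) (g p) ⟩
  g p + ∑ (removeAt g p) + f p         ≡⟨ cong (_+ f p) (sum-remove {i = p} g) ⟨
  ∑ g + f p                            ∎
  where
  open ≡-Reasoning
  rest : ∑ (removeAt f p) ≡ ∑ (removeAt g p)
  rest = sum-cong-≗ λ i → f≗g (punchIn p i) (punchInᵢ≢i p i)
  swap-outer : ∀ a b c → a + b + c ≡ c + b + a
  swap-outer = solve-∀

∑-cong-except₂ : ∀ {n} {f g : Fin n → ℕ} {p q : Fin n} → p ≢ q → (∀ i → i ≢ p → i ≢ q → f i ≡ g i) →
                 ∑ f + (g p + g q) ≡ ∑ g + (f p + f q)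
∑-cong-except₂ {n} {f} {g} {p} {q} p≢q f≗g = begin
  ∑ f + (g p + g q)    ≡⟨ +-assoc (∑ f) (g p) (g q) ⟨
  ∑ f + g p + g q      ≡⟨ cong (λ x → ∑ f + x + g q) (updateAt-updates p f) ⟨
  ∑ f + h p + g q      ≡⟨ cong (_+ g q) (∑-cong-except p f≗h) ⟩
  ∑ h + f p + g q      ≡⟨ swap-last (∑ h) (f p) (g q) ⟩
  ∑ h + g q + f p      ≡⟨ cong (_+ f p) (∑-cong-except q h≗g) ⟩
  ∑ g + h q + f p      ≡⟨ cong (λ x → ∑ g + x + f p) (updateAt-minimal q p f (p≢q ∘ sym)) ⟩
  ∑ g + f q + f p      ≡⟨ swap-last′ (∑ g) (f q) (f p) ⟩
  ∑ g + (f p + f q)    ∎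
  where
  open ≡-Reasoning
  h : Fin n → ℕ
  h = updateAt f p (λ _ → g p)
  f≗h : ∀ i → i ≢ p → f i ≡ h i
  f≗h i i≢p = sym (updateAt-minimal i p f i≢p)
  h≗g : ∀ i → i ≢ q → h i ≡ g i
  h≗g i i≢q with i ≟ᶠ p
  ... | yes refl = updateAt-updates p f
  ... | no i≢p   = trans (updateAt-minimal i p f i≢p) (f≗g i i≢p i≢q)
  swap-last : ∀ a b c → a + b + c ≡ a + c + b
  swap-last = solve-∀
  swap-last′ : ∀ a b c → a + b + c ≡ a + (c + b)
  swap-last′ = solve-∀

∑-δ : ∀ {n} (c : Fin n → ℕ) (a : Fin n) → ∑ (λ v → c v * 𝟙 (a ≟ᶠ v)) ≡ c a
∑-δ {n} c a = begin
  ∑ (λ v → c v * 𝟙 (a ≟ᶠ v))                    ≡⟨ +-identityʳ _ ⟨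
  ∑ (λ v → c v * 𝟙 (a ≟ᶠ v)) + 0                ≡⟨ ∑-cong-except a off-a ⟩
  ∑ {n} (λ _ → 0) + c a * 𝟙 (a ≟ᶠ a)           ≡⟨ cong₂ _+_ (sum-replicate-zero n) (cong (c a *_) (𝟙-yes (a ≟ᶠ a) refl)) ⟩
  c a * 1                                       ≡⟨ *-identityʳ (c a) ⟩
  c a                                           ∎
  where
  open ≡-Reasoning
  off-a : ∀ v → v ≢ a → c v * 𝟙 (a ≟ᶠ v) ≡ 0
  off-a v v≢a = trans (cong (c v *_) (𝟙-no (a ≟ᶠ v) (v≢a ∘ sym))) (*-zeroʳ (c v))

∑-double-count : ∀ {n k} (c : Fin n → ℕ) (h : Fin k → Fin n) →
                 ∑ (λ v → c v * ∑ (λ e → 𝟙 (h e ≟ᶠ v))) ≡ ∑ (λ e → c (h e))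
∑-double-count {k = k} c h = begin
  ∑ (λ v → c v * ∑ (λ e → 𝟙 (h e ≟ᶠ v)))   ≡⟨ sum-cong-≗ (λ v → *-distribˡ-sum {k} (c v) (λ e → 𝟙 (h e ≟ᶠ v))) ⟩
  ∑ (λ v → ∑ (λ e → c v * 𝟙 (h e ≟ᶠ v)))   ≡⟨ ∑-comm (λ v e → c v * 𝟙 (h e ≟ᶠ v)) ⟩
  ∑ (λ e → ∑ (λ v → c v * 𝟙 (h e ≟ᶠ v)))   ≡⟨ sum-cong-≗ (λ e → ∑-δ c (h e)) ⟩
  ∑ (λ e → c (h e))                         ∎
  where open ≡-Reasoning

AllPairs-reverse : ∀ {a r} {A : Set a} {R : Rel A r} {xs} → AllPairs R xs → AllPairs (flip R) (reverse xs)
AllPairs-reverse {xs = []}     []           = []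
AllPairs-reverse {xs = x ∷ xs} (Rx ∷ Rxs) rewrite unfold-reverse x xs =
  AllPairs.++⁺ (AllPairs-reverse Rxs) ([] ∷ [])
    (All.map (λ Rxy → Rxy ∷ []) (All-resp-↭ (↭-sym (↭-reverse xs)) Rx))

-- Stated for any decidable total order on ℕ, so that it serves ≤ for sortInc and ≥ for sortDec.
module SortedLists {_≼_ : Rel ℕ 0ℓ} (≼-isDecTotalOrder : IsDecTotalOrder _≡_ _≼_) where

  open IsDecTotalOrder ≼-isDecTotalOrder
    using (total; antisym) renaming (refl to ≼-refl; trans to ≼-trans; _≤?_ to _≼?_)

  _≺_ : Rel ℕ 0ℓ
  x ≺ y = x ≼ y × x ≢ y

  Sorted : List ℕ → Set
  Sorted = AllPairs _≼_

  count≼ : ℕ → List ℕ → ℕ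
  count≼ j = count (_≼? j)

  ≼-≺-trans : ∀ {x y z} → x ≼ y → y ≺ z → x ≺ z
  ≼-≺-trans x≼y (y≼z , y≢z) = ≼-trans x≼y y≼z , λ { refl → y≢z (antisym y≼z x≼y) }

  ≺-or-≽ : ∀ x y → x ≺ y ⊎ y ≼ x
  ≺-or-≽ x y with x ≟ y | total x y
  ... | yes refl | _        = inj₂ ≼-refl
  ... | no x≢y   | inj₁ x≼y = inj₁ (x≼y , x≢y)
  ... | no _     | inj₂ y≼x = inj₂ y≼x

  uncounted-above : ∀ {j k x} → j ≺ k → k ≼ x → 𝟙 (x ≼? j) ≡ 0
  uncounted-above (j≼k , j≢k) k≼x = 𝟙-no (_ ≼? _) λ x≼j → j≢k (antisym j≼k (≼-trans k≼x x≼j))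

  count≼-above : ∀ {j k xs} → j ≺ k → All (k ≼_) xs → count≼ j xs ≡ 0
  count≼-above j≺k []            = refl
  count≼-above j≺k (k≼x ∷ k≼xs) = cong₂ _+_ (uncounted-above j≺k k≼x) (count≼-above j≺k k≼xs)

  count≼-self : ∀ a xs → count≼ a (a ∷ xs) ≡ suc (count≼ a xs)
  count≼-self a xs = cong (_+ count≼ a xs) (𝟙-yes (a ≼? a) ≼-refl)

  count≼-below-head : ∀ {a b w} → a ≺ b → Sorted (b ∷ w) → count≼ a (b ∷ w) ≡ 0
  count≼-below-head a≺b (b≼w ∷ _) = count≼-above a≺b (≼-refl ∷ b≼w)

  count≼-heads-≢ : ∀ {a b w} u → a ≺ b → Sorted (b ∷ w) → count≼ a (a ∷ u) ≢ count≼ a (b ∷ w)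
  count≼-heads-≢ {a} u a≺b sw eq =
    1+n≢0 (trans (sym (count≼-self a u)) (trans eq (count≼-below-head a≺b sw)))

  sorted-≡ : ∀ {u w} → Sorted u → Sorted w → (∀ j → count≼ j u ≡ count≼ j w) → u ≡ w
  sorted-≡ {[]}    {[]}    _ _ _    = refl
  sorted-≡ {[]}    {b ∷ w} _ _ same = ⊥-elim (0≢1+n (trans (same b) (count≼-self b w)))
  sorted-≡ {a ∷ u} {[]}    _ _ same = ⊥-elim (1+n≢0 (trans (sym (count≼-self a u)) (same a)))
  sorted-≡ {a ∷ u} {b ∷ w} su@(_ ∷ su′) sw@(_ ∷ sw′) same with a ≟ b
  ... | yes refl = cong (a ∷_) (sorted-≡ su′ sw′ λ j → +-cancelˡ-≡ _ _ _ (same j))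
  ... | no a≢b with total a b
  ...   | inj₁ a≼b = contradiction (same a) (count≼-heads-≢ u (a≼b , a≢b) sw)
  ...   | inj₂ b≼a = contradiction (sym (same b)) (count≼-heads-≢ w (b≼a , a≢b ∘ sym) su)

  sorted-< : ∀ {u w} → Sorted u → Sorted w → length u ≡ length w → ∀ j →
             (∀ i → i ≺ j → count≼ i u ≡ count≼ i w) → count≼ j w < count≼ j u →
             Lex-< _≡_ _≼_ u w
  sorted-< {[]}    {[]}    _ _ _ _ _ ()
  sorted-< {a ∷ u} {b ∷ w} su@(_ ∷ su′) sw@(_ ∷ sw′) len j below fewer with a ≟ b
  ... | yes refl = next refl (sorted-< su′ sw′ (suc-injective len) j
                     (λ i i≺j → +-cancelˡ-≡ _ _ _ (below i i≺j)) (+-cancelˡ-< _ _ _ fewer))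
  ... | no a≢b with total a b
  ...   | inj₁ a≼b = this (a≼b , a≢b)
  ...   | inj₂ b≼a with ≺-or-≽ b j
  ...     | inj₁ b≺j = contradiction (sym (below b b≺j)) (count≼-heads-≢ w (b≼a , a≢b ∘ sym) su)
  ...     | inj₂ j≼b = ⊥-elim (n≮0 (subst (count≼ j (b ∷ w) <_)
                         (count≼-below-head (≼-≺-trans j≼b (b≼a , a≢b ∘ sym)) su) fewer))

  #≼ : ∀ {n} → (Fin n → ℕ) → ℕ → ℕ
  #≼ y j = ∑ λ v → 𝟙 (y v ≼? j)

  count≼-↭-tabulate : ∀ {n u} (y : Fin n → ℕ) → u ↭ tabulate y → ∀ j → count≼ j u ≡ #≼ y j
  count≼-↭-tabulate y u↭y j = trans (count-↭ _ u↭y) (count-tabulate _ y)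

  module TwoPointChange {n} {y y′ : Fin n → ℕ} {p q : Fin n} (p≢q : p ≢ q)
                        (unchanged : ∀ v → v ≢ p → v ≢ q → y v ≡ y′ v) where

    balance : ∀ j → #≼ y′ j + (𝟙 (y p ≼? j) + 𝟙 (y q ≼? j)) ≡ #≼ y j + (𝟙 (y′ p ≼? j) + 𝟙 (y′ q ≼? j))
    balance j = ∑-cong-except₂ p≢q λ v v≢p v≢q → cong (λ x → 𝟙 (x ≼? j)) (sym (unchanged v v≢p v≢q))

    #≼-swap : y′ p ≡ y q → y′ q ≡ y p → ∀ j → #≼ y j ≡ #≼ y′ j
    #≼-swap p←q q←p j = +-cancelʳ-≡ _ _ _ (sym (trans (balance j) (cong (#≼ y j +_) swapped)))
      where
      swapped : 𝟙 (y′ p ≼? j) + 𝟙 (y′ q ≼? j) ≡ 𝟙 (y p ≼? j) + 𝟙 (y q ≼? j)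
      swapped rewrite p←q | q←p = +-comm (𝟙 (y q ≼? j)) (𝟙 (y p ≼? j))

    sorted-≡-swap : y′ p ≡ y q → y′ q ≡ y p → ∀ {u w} → Sorted u → Sorted w →
                    u ↭ tabulate y → w ↭ tabulate y′ → u ≡ w
    sorted-≡-swap p←q q←p su sw u↭y w↭y′ = sorted-≡ su sw λ j →
      trans (count≼-↭-tabulate y u↭y j) (trans (#≼-swap p←q q←p j) (sym (count≼-↭-tabulate y′ w↭y′ j)))

    module _ (p↑ : y p ≺ y′ p) (q-above : y p ≺ y q) (q′-above : y p ≺ y′ q) where

      #≼-below : ∀ i → i ≺ y p → #≼ y i ≡ #≼ y′ i
      #≼-below i i≺yp = begin
        #≼ y i                                    ≡⟨ +-identityʳ _ ⟨
        #≼ y i + (0 + 0)                          ≡⟨ cong (#≼ y i +_) (cong₂ _+_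
                                                       (uncounted-above i≺yp (proj₁ p↑))
                                                       (uncounted-above i≺yp (proj₁ q′-above))) ⟨
        #≼ y i + (𝟙 (y′ p ≼? i) + 𝟙 (y′ q ≼? i))  ≡⟨ balance i ⟨
        #≼ y′ i + (𝟙 (y p ≼? i) + 𝟙 (y q ≼? i))   ≡⟨ cong (#≼ y′ i +_) (cong₂ _+_
                                                       (uncounted-above i≺yp ≼-refl)
                                                       (uncounted-above i≺yp (proj₁ q-above))) ⟩
        #≼ y′ i + (0 + 0)                         ≡⟨ +-identityʳ _ ⟩
        #≼ y′ i                                   ∎
        where open ≡-Reasoning

      #≼-at : suc (#≼ y′ (y p)) ≡ #≼ y (y p)
      #≼-at = begin
        suc (#≼ y′ (y p))                                ≡⟨ +-comm 1 _ ⟩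
        #≼ y′ (y p) + (1 + 0)                            ≡⟨ cong (#≼ y′ (y p) +_) (cong₂ _+_
                                                              (𝟙-yes (y p ≼? y p) ≼-refl)
                                                              (uncounted-above q-above ≼-refl)) ⟨
        #≼ y′ (y p) + (𝟙 (y p ≼? y p) + 𝟙 (y q ≼? y p))  ≡⟨ balance (y p) ⟩
        #≼ y (y p) + (𝟙 (y′ p ≼? y p) + 𝟙 (y′ q ≼? y p)) ≡⟨ cong (#≼ y (y p) +_) (cong₂ _+_
                                                              (uncounted-above p↑ ≼-refl)
                                                              (uncounted-above q′-above ≼-refl)) ⟩
        #≼ y (y p) + 0                                   ≡⟨ +-identityʳ _ ⟩
        #≼ y (y p)                                       ∎
        where open ≡-Reasoning

      sorted-<-raise : ∀ {u w} → Sorted u → Sorted w → u ↭ tabulate y → w ↭ tabulate y′ → Lex-< _≡_ _≼_ u w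
      sorted-<-raise su sw u↭y w↭y′ = sorted-< su sw
        (trans (↭-length u↭y) (trans (length-tabulate y) (sym (trans (↭-length w↭y′) (length-tabulate y′)))))
        (y p)
        (λ i i≺yp → trans (count≼-↭-tabulate y u↭y i) (trans (#≼-below i i≺yp) (sym (count≼-↭-tabulate y′ w↭y′ i))))
        (subst₂ (λ c c′ → suc c ≤ c′) (sym (count≼-↭-tabulate y′ w↭y′ (y p))) (sym (count≼-↭-tabulate y u↭y (y p)))
          (≤-reflexive #≼-at))

_<lex_ : List ℕ → List ℕ → Set
_<lex_ = Lex-< _≡_ _≤_

<lex⇒≤lex : ∀ {u w} → u <lex w → u ≤lex w
<lex⇒≤lex halt           = halt
<lex⇒≤lex (this u≺w)     = this u≺w
<lex⇒≤lex (next eq u<w)  = next eq (<lex⇒≤lex u<w)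

<lex⇒≱lex : ∀ {u w} → u <lex w → ¬ w ≤lex u
<lex⇒≱lex u<w w≤u = Lex.<-irreflexive (Lex.≤-antisymmetric sym ≤-antisym (<lex⇒≤lex u<w) w≤u) u<w

≤lex-trans : ∀ {u v w} → u ≤lex v → v ≤lex w → u ≤lex w
≤lex-trans = Lex.≤-transitive ≤-isPartialOrder

≡⇒≤lex : ∀ {u w} → u ≡ w → u ≤lex w
≡⇒≤lex u≡w = Lex.≤-reflexive _≡_ _≤_ (≡⇒Pointwise-≡ u≡w)

module Ascending = SortedLists ≤-isDecTotalOrder
module Descending = SortedLists (Flip.isDecTotalOrder ≤-isDecTotalOrder)

flip-<lex : ∀ {u w} → length u ≡ length w → Lex-< _≡_ (flip _≤_) u w → w <lex u
flip-<lex ()  halt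
flip-<lex _   (this (w≤u , u≢w)) = this (w≤u , u≢w ∘ sym)
flip-<lex len (next refl u<w)    = next refl (flip-<lex (suc-injective len) u<w)

values : ∀ {n} → (Fin n → ℕ) → List ℕ
values {n} y = map y (allFin n)

sortInc-sorted : ∀ xs → Ascending.Sorted (sortInc xs)
sortInc-sorted xs = Sorted⇒AllPairs ≤-totalOrder (sort-↗ xs)

sortDec-sorted : ∀ xs → Descending.Sorted (sortDec xs)
sortDec-sorted xs = AllPairs-reverse (sortInc-sorted xs)

sortInc-↭ : ∀ {n} (y : Fin n → ℕ) → sortInc (values y) ↭ tabulate y
sortInc-↭ y = ↭-trans (sort-↭ (values y)) (↭-reflexive (map-tabulate id y))

sortDec-↭ : ∀ {n} (y : Fin n → ℕ) → sortDec (values y) ↭ tabulate y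
sortDec-↭ y = ↭-trans (↭-reverse (sortInc (values y))) (sortInc-↭ y)

sortDec-length : ∀ {n} (y : Fin n → ℕ) → length (sortDec (values y)) ≡ n
sortDec-length y = trans (↭-length (sortDec-↭ y)) (length-tabulate y)

record UnitTransfer {n} (y y′ : Fin n → ℕ) (a b : Fin n) : Set where
  field
    a≢b       : a ≢ b
    raised    : y′ a ≡ suc (y a)
    lowered   : suc (y′ b) ≡ y b
    unchanged : ∀ v → v ≢ a → v ≢ b → y v ≡ y′ v

module _ {n} {y y′ : Fin n → ℕ} {a b : Fin n} (T : UnitTransfer y y′ a b) where
  open UnitTransfer T

  transfer-sortInc-≡ : y b ≡ suc (y a) → sortInc (values y) ≡ sortInc (values y′)
  transfer-sortInc-≡ yb≡ = Ascending.TwoPointChange.sorted-≡-swap a≢b unchanged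
    (trans raised (sym yb≡)) (suc-injective (trans lowered yb≡))
    (sortInc-sorted _) (sortInc-sorted _) (sortInc-↭ y) (sortInc-↭ y′)

  module _ (ya+2≤yb : 2 + y a ≤ y b) where

    private
      ya<yb : y a < y b
      ya<yb = ≤-trans (n≤1+n _) ya+2≤yb

      ya<y′b : y a < y′ b
      ya<y′b = s≤s⁻¹ (subst (2 + y a ≤_) (sym lowered) ya+2≤yb)

      y′a<yb : y′ a < y b
      y′a<yb = subst (λ x → suc x ≤ y b) (sym raised) ya+2≤yb

    transfer-sortInc-< : sortInc (values y) <lex sortInc (values y′)
    transfer-sortInc-< = Ascending.TwoPointChange.sorted-<-raise a≢b unchanged
      (ascend (subst (y a <_) (sym raised) ≤-refl)) (ascend ya<yb) (ascend ya<y′b)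
      (sortInc-sorted _) (sortInc-sorted _) (sortInc-↭ y) (sortInc-↭ y′)
      where
      ascend : ∀ {x z} → x < z → x ≤ z × x ≢ z
      ascend x<z = <⇒≤ x<z , <⇒≢ x<z

    transfer-sortDec-< : sortDec (values y′) <lex sortDec (values y)
    transfer-sortDec-< = flip-<lex (trans (sortDec-length y) (sym (sortDec-length y′)))
      (Descending.TwoPointChange.sorted-<-raise (a≢b ∘ sym) (λ v v≢b v≢a → unchanged v v≢a v≢b)
        (descend (≤-reflexive lowered)) (descend ya<yb) (descend y′a<yb)
        (sortDec-sorted _) (sortDec-sorted _) (sortDec-↭ y) (sortDec-↭ y′))
      where
      descend : ∀ {x z} → z < x → z ≤ x × x ≢ z
      descend z<x = <⇒≤ z<x , >⇒≢ z<x

module Reachability {n} {E : Rel (Fin n) 0ℓ} (E? : Decidable₂ E) (s : Fin n) where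

  Reach : ℕ → Fin n → Set
  Reach zero    v = s ≡ v
  Reach (suc k) v = Reach k v ⊎ ∃ λ u → Reach k u × E u v

  Reach? : ∀ k → Decidable (Reach k)
  Reach? zero    v = s ≟ᶠ v
  Reach? (suc k) v = Reach? k v ⊎-dec any? λ u → Reach? k u ×-dec E? u v

  Reach-source : ∀ k → Reach k s
  Reach-source zero    = refl
  Reach-source (suc k) = inj₁ (Reach-source k)

  Reach⇒Star : ∀ {k v} → Reach k v → Star E s v
  Reach⇒Star {zero}  refl                = ε
  Reach⇒Star {suc k} (inj₁ r)            = Reach⇒Star r
  Reach⇒Star {suc k} (inj₂ (u , r , uv)) = Reach⇒Star r ◅◅ (uv ◅ ε)

  size : ℕ → ℕ
  size k = ∑ (𝟙 ∘ Reach? k)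

  Saturated : ℕ → Set
  Saturated k = ∀ {u v} → Reach k u → E u v → Reach k v

  saturated-or-growing : ∀ k → (∃ Saturated) ⊎ k < size k
  saturated-or-growing zero = inj₂ (subst (_≤ size 0) (𝟙-yes (s ≟ᶠ s) refl) (term≤∑ (𝟙 ∘ Reach? 0) s))
  saturated-or-growing (suc k) with saturated-or-growing k
  ... | inj₁ sat = inj₁ sat
  ... | inj₂ k<size with any? (λ v → Reach? (suc k) v ×-dec ¬? (Reach? k v))
  ...   | yes (v , new , ¬old) = inj₂ (<-≤-trans (s≤s k<size) (∑-mono-<
            (λ u → 𝟙-mono (Reach? k u) (Reach? (suc k) u) inj₁) v
            (subst₂ _<_ (sym (𝟙-no (Reach? k v) ¬old)) (sym (𝟙-yes (Reach? (suc k) v) new)) ≤-refl)))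
  ...   | no no-new = inj₁ (k , λ {u} {v} ru uv →
            decidable-stable (Reach? k v) λ ¬old → no-new (v , inj₂ (u , ru , uv) , ¬old))

  saturation : ∃ Saturated
  saturation with saturated-or-growing n
  ... | inj₁ sat    = sat
  ... | inj₂ n<size = ⊥-elim (<⇒≱ n<size (∑-bounded (𝟙≤1 ∘ Reach? n)))

  Star⇒Reach : ∀ {u v} → Reach (proj₁ saturation) u → Star E u v → Reach (proj₁ saturation) v
  Star⇒Reach ru ε          = ru
  Star⇒Reach ru (uw ◅ wv) = Star⇒Reach (proj₂ saturation ru uw) wv

Star? : ∀ {n} {E : Rel (Fin n) 0ℓ} → Decidable₂ E → Decidable₂ (Star E)
Star? E? s v = map′ Reach⇒Star (Star⇒Reach (Reach-source _)) (Reach? (proj₁ saturation) v)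
  where open Reachability E? s

module Orientations {n m : ℕ} (G : Graph n m) where

  endpoint : Bool → Fin m → Fin n
  endpoint true  e = proj₂ (ends G e)
  endpoint false e = proj₁ (ends G e)

  head≡endpoint : ∀ D e → head G D e ≡ endpoint (D e) e
  head≡endpoint D e with D e
  ... | true  = refl
  ... | false = refl

  tail : Orientation m → Fin m → Fin n
  tail D e = endpoint (not (D e)) e

  tail≢head : ∀ D e → tail D e ≢ head G D e
  tail≢head D e tail≡head = endpoints-≢ (D e) (trans tail≡head (head≡endpoint D e))
    where
    endpoints-≢ : ∀ b → endpoint (not b) e ≢ endpoint b e
    endpoints-≢ true  = loopless G e
    endpoints-≢ false = loopless G e ∘ sym

  head-agree : ∀ D D′ {e} → D e ≡ D′ e → head G D e ≡ head G D′ e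
  head-agree D D′ {e} D≡D′ =
    trans (head≡endpoint D e) (trans (cong (λ b → endpoint b e) D≡D′) (sym (head≡endpoint D′ e)))

  head-differ : ∀ D D′ {e} → D e ≢ D′ e → head G D′ e ≡ tail D e
  head-differ D D′ {e} D≢D′ = trans (head≡endpoint D′ e) (cong (λ b → endpoint b e) (¬-not (D≢D′ ∘ sym)))

  tail-differ : ∀ D D′ {e} → D e ≢ D′ e → tail D′ e ≡ head G D e
  tail-differ D D′ {e} D≢D′ =
    trans (cong (λ b → endpoint b e) (sym (¬-not D≢D′))) (sym (head≡endpoint D e))

  tail-agree : ∀ D D′ {e} → D e ≡ D′ e → tail D e ≡ tail D′ e
  tail-agree D D′ {e} D≡D′ = cong (λ b → endpoint (not b) e) D≡D′

  reverseArc : Orientation m → Fin m → Orientation m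
  reverseArc D e = updateAt D e not

  reverseArc-differs : ∀ D e → D e ≢ reverseArc D e e
  reverseArc-differs D e D≡ = not-¬ refl (trans D≡ (updateAt-updates e D))

  reverseArc-agrees : ∀ D e {e′} → e′ ≢ e → D e′ ≡ reverseArc D e e′
  reverseArc-agrees D e {e′} e′≢e = sym (updateAt-minimal e′ e D e′≢e)

  indeg-∑ : ∀ D v → indeg G D v ≡ ∑ λ e → 𝟙 (head G D e ≟ᶠ v)
  indeg-∑ D v = trans (length-filter _ (allFin m)) (count-tabulate (λ e → head G D e ≟ᶠ v) {m} id)

  indeg-reverseArc : ∀ D e v → indeg G (reverseArc D e) v + 𝟙 (head G D e ≟ᶠ v) ≡ indeg G D v + 𝟙 (tail D e ≟ᶠ v)
  indeg-reverseArc D e v = begin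
    indeg G D′ v + 𝟙 (head G D e ≟ᶠ v)                     ≡⟨ cong (_+ 𝟙 (head G D e ≟ᶠ v)) (indeg-∑ D′ v) ⟩
    ∑ (λ i → 𝟙 (head G D′ i ≟ᶠ v)) + 𝟙 (head G D e ≟ᶠ v)  ≡⟨ ∑-cong-except e (λ i i≢e → cong (λ w → 𝟙 (w ≟ᶠ v))
                                                                (sym (head-agree D D′ (reverseArc-agrees D e i≢e)))) ⟩
    ∑ (λ i → 𝟙 (head G D i ≟ᶠ v)) + 𝟙 (head G D′ e ≟ᶠ v)  ≡⟨ cong₂ _+_ (sym (indeg-∑ D v))
                                                                (cong (λ w → 𝟙 (w ≟ᶠ v)) (head-differ D D′ (reverseArc-differs D e))) ⟩
    indeg G D v + 𝟙 (tail D e ≟ᶠ v)                        ∎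
    where
    open ≡-Reasoning
    D′ = reverseArc D e

  reverseArc-transfer : ∀ D e → UnitTransfer (indeg G D) (indeg G (reverseArc D e)) (tail D e) (head G D e)
  reverseArc-transfer D e = record
    { a≢b       = a≢b
    ; raised    = trans (sym (+-identityʳ _)) (trans (at a (𝟙-no (b ≟ᶠ a) (a≢b ∘ sym)) (𝟙-yes (a ≟ᶠ a) refl)) (+-comm _ 1))
    ; lowered   = trans (+-comm 1 _) (trans (at b (𝟙-yes (b ≟ᶠ b) refl) (𝟙-no (a ≟ᶠ b) a≢b)) (+-identityʳ _))
    ; unchanged = λ v v≢a v≢b → +-cancelʳ-≡ 0 _ _ (sym (at v (𝟙-no (b ≟ᶠ v) (v≢b ∘ sym)) (𝟙-no (a ≟ᶠ v) (v≢a ∘ sym))))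
    }
    where
    a = tail D e
    b = head G D e
    a≢b = tail≢head D e
    at : ∀ v {i j} → 𝟙 (b ≟ᶠ v) ≡ i → 𝟙 (a ≟ᶠ v) ≡ j → indeg G (reverseArc D e) v + i ≡ indeg G D v + j
    at v refl refl = indeg-reverseArc D e v

  record _⊴_ (D D′ : Orientation m) : Set where
    constructor _,_
    field
      decreasing : sortDec (inVec G D) ≤lex sortDec (inVec G D′)
      increasing : sortInc (inVec G D′) ≤lex sortInc (inVec G D)

  record _◁_ (D D′ : Orientation m) : Set where
    constructor _,_
    field
      decreasing : sortDec (inVec G D) <lex sortDec (inVec G D′)
      increasing : sortInc (inVec G D′) <lex sortInc (inVec G D)

  ⊴-trans : ∀ {D₁ D₂ D₃} → D₁ ⊴ D₂ → D₂ ⊴ D₃ → D₁ ⊴ D₃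
  ⊴-trans (dec₁₂ , inc₁₂) (dec₂₃ , inc₂₃) = ≤lex-trans dec₁₂ dec₂₃ , ≤lex-trans inc₂₃ inc₁₂

  inVec-≡⇒⊴ : ∀ {D D′} → inVec G D ≡ inVec G D′ → D ⊴ D′
  inVec-≡⇒⊴ eq = ≡⇒≤lex (cong sortDec eq) , ≡⇒≤lex (cong sortInc (sym eq))

  ◁-resp-sortInc : ∀ {D D₁ D₂} → sortInc (inVec G D₁) ≡ sortInc (inVec G D₂) → D ◁ D₁ → D ◁ D₂
  ◁-resp-sortInc eq (dec< , inc<) = subst (_ <lex_) (cong reverse eq) dec< , subst (_<lex _) eq inc<

  module _ (D : Orientation m) (e : Fin m) where

    private
      x = indeg G D

    reverseArc-sortInc-≡ : x (head G D e) ≡ suc (x (tail D e)) → sortInc (inVec G (reverseArc D e)) ≡ sortInc (inVec G D)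
    reverseArc-sortInc-≡ level = sym (transfer-sortInc-≡ (reverseArc-transfer D e) level)

    reverseArc-◁ : 2 + x (tail D e) ≤ x (head G D e) → reverseArc D e ◁ D
    reverseArc-◁ steep = transfer-sortDec-< (reverseArc-transfer D e) steep , transfer-sortInc-< (reverseArc-transfer D e) steep

    reverseArc-⊴ : suc (x (tail D e)) ≤ x (head G D e) → reverseArc D e ⊴ D
    reverseArc-⊴ uphill with m≤n⇒m<n∨m≡n uphill
    ... | inj₁ steep = let (dec< , inc<) = reverseArc-◁ steep in <lex⇒≤lex dec< , <lex⇒≤lex inc<
    ... | inj₂ level = let inc≡ = reverseArc-sortInc-≡ (sym level) in ≡⇒≤lex (cong reverse inc≡) , ≡⇒≤lex (sym inc≡)

  data Path (D : Orientation m) : Fin n → Fin n → ℕ → Set where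
    []  : ∀ {v} → Path D v v 0
    arc : ∀ {u w ℓ} e → tail D e ≡ u → Path D (head G D e) w ℓ → Path D u w (suc ℓ)

  NoImprovingPath : Orientation m → Set
  NoImprovingPath D = ∀ {s t ℓ} → Path D s t ℓ → indeg G D t ≤ suc (indeg G D s)

  Path-reverseArc : ∀ D e {u t ℓ} → Path D u t ℓ →
                    Path (reverseArc D e) u t ℓ ⊎ ∃ λ ℓ′ → ℓ′ ≤ ℓ × Path D (tail D e) t ℓ′
  Path-reverseArc D e []               = inj₁ []
  Path-reverseArc D e (arc e′ refl p) with e′ ≟ᶠ e
  ... | yes refl = inj₂ (_ , ≤-refl , arc e refl p)
  ... | no e′≢e with Path-reverseArc D e p
  ...   | inj₁ q = inj₁ (arc e′ (sym (tail-agree D (reverseArc D e) {e′} (reverseArc-agrees D e e′≢e)))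
                            (subst (λ v → Path _ v _ _) (head-agree D (reverseArc D e) {e′} (reverseArc-agrees D e e′≢e)) q))
  ...   | inj₂ (ℓ′ , ℓ′≤ℓ , q) = inj₂ (ℓ′ , m≤n⇒m≤1+n ℓ′≤ℓ , q)

  -- ℓ ≤ k is the termination measure: in the level case the walk either continues in
  -- reverseArc D e, or restarts at a later use of e, which is again a walk out of the same vertex.
  improving-path⇒◁ : ∀ k D {s t ℓ} → ℓ ≤ k → Path D s t ℓ → 2 + indeg G D s ≤ indeg G D t → ∃ λ D′ → D′ ◁ D
  improving-path⇒◁ k       D _  []  improving = ⊥-elim (<⇒≱ improving (n≤1+n _))
  improving-path⇒◁ zero    D () (arc _ _ _) _
  improving-path⇒◁ (suc k) D {t = t} (s≤s ℓ≤k) (arc e refl p) improving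
    with <-cmp (indeg G D (head G D e)) (suc (indeg G D (tail D e)))
  ... | tri> _ _ steep = reverseArc D e , reverseArc-◁ D e steep
  ... | tri< down _ _  = improving-path⇒◁ k D ℓ≤k p (≤-trans (s≤s (s≤s (s≤s⁻¹ down))) improving)
  ... | tri≈ _ level _ with Path-reverseArc D e p
  ...   | inj₂ (_ , ℓ′≤ℓ , q) = improving-path⇒◁ k D (≤-trans ℓ′≤ℓ ℓ≤k) q improving
  ...   | inj₁ q = let D″ , D″◁D₁ = improving-path⇒◁ k D₁ ℓ≤k q improving₁
                   in D″ , ◁-resp-sortInc (reverseArc-sortInc-≡ D e level) D″◁D₁
    where
    D₁ = reverseArc D e
    open UnitTransfer (reverseArc-transfer D e)
    t≢tail : t ≢ tail D e
    t≢tail refl = <⇒≱ improving (n≤1+n _)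
    t≢head : t ≢ head G D e
    t≢head refl = <⇒≱ improving (≤-reflexive level)
    improving₁ : 2 + indeg G D₁ (head G D e) ≤ indeg G D₁ t
    improving₁ = subst₂ (λ u v → 2 + u ≤ v) (sym (suc-injective (trans lowered level))) (unchanged t t≢tail t≢head) improving

  ◁-minimal⇒NoImprovingPath : ∀ D → (∀ D′ → ¬ D′ ◁ D) → NoImprovingPath D
  ◁-minimal⇒NoImprovingPath D minimal {ℓ = ℓ} p = decidable-stable (_ ≤? _) λ ¬ok →
    minimal _ (proj₂ (improving-path⇒◁ ℓ D ≤-refl p (≰⇒> ¬ok)))

  indeg-weighted-∑ : ∀ D {R : Pred (Fin n) 0ℓ} (R? : Decidable R) →
                     ∑ (λ v → 𝟙 (R? v) * indeg G D v) ≡ ∑ (λ e → 𝟙 (R? (head G D e)))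
  indeg-weighted-∑ D R? =
    trans (sum-cong-≗ λ v → cong (𝟙 (R? v) *_) (indeg-∑ D v)) (∑-double-count (𝟙 ∘ R?) (head G D))

  head-closed⇒∃<indeg : ∀ A B {R : Pred (Fin n) 0ℓ} (R? : Decidable R) → (∀ e → R (head G A e) → R (head G B e)) →
                        ∀ {t} → R t → indeg G B t < indeg G A t → ∃ λ s → R s × indeg G A s < indeg G B s
  head-closed⇒∃<indeg A B R? closed {t} Rt fewer =
    let s , less = ∑-≤⇒∃< weighted-≤ t (subst₂ _<_ (sym (𝟙*-yes (R? t) Rt)) (sym (𝟙*-yes (R? t) Rt)) fewer)
    in s , 𝟙*-<⇒ (R? s) less
    where
    weighted-≤ : ∑ (λ v → 𝟙 (R? v) * indeg G A v) ≤ ∑ (λ v → 𝟙 (R? v) * indeg G B v)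
    weighted-≤ = subst₂ _≤_ (sym (indeg-weighted-∑ A R?)) (sym (indeg-weighted-∑ B R?))
                   (∑-mono-≤ λ e → 𝟙-mono (R? (head G A e)) (R? (head G B e)) (closed e))

  module Optimality (D : Orientation m) (no-improving : NoImprovingPath D) where

    module _ (D′ : Orientation m)
             (downhill : ∀ e → D e ≢ D′ e → indeg G D′ (tail D e) ≤ indeg G D′ (head G D e)) where

      Reversed : Rel (Fin n) 0ℓ
      Reversed u w = ∃ λ e → D e ≢ D′ e × tail D e ≡ u × head G D e ≡ w

      Reversed? : Decidable₂ Reversed
      Reversed? u w = any? λ e → ¬? (D e ≟ᵇ D′ e) ×-dec (tail D e ≟ᶠ u ×-dec head G D e ≟ᶠ w)

      Reversed⇒Path : ∀ {u w} → Star Reversed u w → ∃ (Path D u w)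
      Reversed⇒Path ε                             = 0 , []
      Reversed⇒Path ((e , _ , refl , refl) ◅ u⇝w) =
        let ℓ , p = Reversed⇒Path u⇝w in suc ℓ , arc e refl p

      Reversed-mono : ∀ {u w} → Star Reversed u w → indeg G D′ u ≤ indeg G D′ w
      Reversed-mono ε                                  = ≤-refl
      Reversed-mono ((e , D≢D′ , refl , refl) ◅ u⇝w) = ≤-trans (downhill e D≢D′) (Reversed-mono u⇝w)

      reversed-arc : ∀ e → D e ≢ D′ e → Reversed (head G D′ e) (head G D e)
      reversed-arc e D≢D′ = e , D≢D′ , sym (head-differ D D′ D≢D′) , refl

      -- Every arc with D-head in R = {v : v ⇝ t} has its D′-head in R, so if t lost in-degree,
      -- some s ∈ R gained some, and then ϱ_D(t) ≤ ϱ_D(s) + 1 ≤ ϱ_D′(s) ≤ ϱ_D′(t).  Dually for indeg-≥.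
      indeg-≤ : ∀ t → indeg G D t ≤ indeg G D′ t
      indeg-≤ t = decidable-stable (_ ≤? _) λ ≰ →
        let s , s⇝t , less = head-closed⇒∃<indeg D D′ (λ v → Star? Reversed? v t) closed ε (≰⇒> ≰)
        in ≰ (≤-trans (no-improving (proj₂ (Reversed⇒Path s⇝t))) (≤-trans less (Reversed-mono s⇝t)))
        where
        closed : ∀ e → Star Reversed (head G D e) t → Star Reversed (head G D′ e) t
        closed e ⇝t with D e ≟ᵇ D′ e
        ... | yes D≡D′ = subst (λ v → Star Reversed v t) (head-agree D D′ D≡D′) ⇝t
        ... | no D≢D′  = reversed-arc e D≢D′ ◅ ⇝t

      indeg-≥ : ∀ t → indeg G D′ t ≤ indeg G D t
      indeg-≥ t = decidable-stable (_ ≤? _) λ ≰ →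
        let s , t⇝s , less = head-closed⇒∃<indeg D′ D (Star? Reversed? t) closed ε (≰⇒> ≰)
        in ≰ (s≤s⁻¹ (≤-trans (s≤s (Reversed-mono t⇝s)) (≤-trans less (no-improving (proj₂ (Reversed⇒Path t⇝s))))))
        where
        closed : ∀ e → Star Reversed t (head G D′ e) → Star Reversed t (head G D e)
        closed e t⇝ with D e ≟ᵇ D′ e
        ... | yes D≡D′ = subst (Star Reversed t) (sym (head-agree D D′ D≡D′)) t⇝
        ... | no D≢D′  = t⇝ ◅◅ (reversed-arc e D≢D′ ◅ ε)

      same-inVec : inVec G D ≡ inVec G D′
      same-inVec = map-cong (λ v → ≤-antisym (indeg-≤ v) (indeg-≥ v)) (allFin n)

    distance : Orientation m → ℕ
    distance D′ = ∑ λ e → 𝟙 (¬? (D e ≟ᵇ D′ e))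

    distance-reverseArc : ∀ D′ e → D e ≢ D′ e → suc (distance (reverseArc D′ e)) ≡ distance D′
    distance-reverseArc D′ e D≢D′ = begin
      suc (distance D″)                          ≡⟨ +-comm 1 _ ⟩
      distance D″ + 1                            ≡⟨ cong (distance D″ +_) (𝟙-yes (¬? (D e ≟ᵇ D′ e)) D≢D′) ⟨
      distance D″ + 𝟙 (¬? (D e ≟ᵇ D′ e))        ≡⟨ ∑-cong-except e (λ i i≢e → cong (λ b → 𝟙 (¬? (D i ≟ᵇ b)))
                                                                     (sym (reverseArc-agrees D′ e i≢e))) ⟩
      distance D′ + 𝟙 (¬? (D e ≟ᵇ D″ e))        ≡⟨ cong (distance D′ +_) (𝟙-no (¬? (D e ≟ᵇ D″ e)) (λ D≢D″ → D≢D″ D≡D″)) ⟩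
      distance D′ + 0                            ≡⟨ +-identityʳ _ ⟩
      distance D′                                ∎
      where
      open ≡-Reasoning
      D″ = reverseArc D′ e
      D≡D″ : D e ≡ D″ e
      D≡D″ = trans (¬-not D≢D′) (sym (updateAt-updates e D′))

    ⊴-within : ∀ k D′ → distance D′ ≡ k → D ⊴ D′
    ⊴-within k D′ dist
      with any? (λ e → ¬? (D e ≟ᵇ D′ e) ×-dec (suc (indeg G D′ (tail D′ e)) ≤? indeg G D′ (head G D′ e)))
    ... | no none = inVec-≡⇒⊴ (same-inVec D′ downhill)
      where
      downhill : ∀ e → D e ≢ D′ e → indeg G D′ (tail D e) ≤ indeg G D′ (head G D e)
      downhill e D≢D′ = subst₂ _≤_ (cong (indeg G D′) (head-differ D D′ D≢D′)) (cong (indeg G D′) (tail-differ D D′ D≢D′))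
                          (≮⇒≥ λ uphill → none (e , D≢D′ , uphill))
    ⊴-within zero    D′ dist | yes (e , D≢D′ , _) =
      ⊥-elim (n≮0 (subst₂ _≤_ (𝟙-yes (¬? (D e ≟ᵇ D′ e)) D≢D′) dist (term≤∑ _ e)))
    ⊴-within (suc k) D′ dist | yes (e , D≢D′ , uphill) =
      ⊴-trans (⊴-within k (reverseArc D′ e) (suc-injective (trans (distance-reverseArc D′ e D≢D′) dist)))
              (reverseArc-⊴ D′ e uphill)

  ◁-minimal⇒⊴-least : ∀ {D} → (∀ D′ → ¬ D′ ◁ D) → ∀ D′ → D ⊴ D′
  ◁-minimal⇒⊴-least {D} minimal D′ = Optimality.⊴-within D (◁-minimal⇒NoImprovingPath D minimal) _ D′ refl

  DecMin⇒◁-minimal : ∀ D → DecMin G D → ∀ D′ → ¬ D′ ◁ D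
  DecMin⇒◁-minimal D decMin D′ D′◁D = <lex⇒≱lex (_◁_.decreasing D′◁D) (decMin D′)

  IncMax⇒◁-minimal : ∀ D → IncMax G D → ∀ D′ → ¬ D′ ◁ D
  IncMax⇒◁-minimal D incMax D′ D′◁D = <lex⇒≱lex (_◁_.increasing D′◁D) (incMax D′)

corollary8p3 : ∀ {n m : ℕ} (G : Graph n m) (D : Orientation m) → DecMin G D ⇔ IncMax G D
corollary8p3 G D = mk⇔
  (λ decMin → _⊴_.increasing ∘ ◁-minimal⇒⊴-least (DecMin⇒◁-minimal D decMin))
  (λ incMax → _⊴_.decreasing ∘ ◁-minimal⇒⊴-least (IncMax⇒◁-minimal D incMax))
  where open Orientations G
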